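{- Let $S\subseteq\mathbb{F}_2^n$ be a Sidon set. The Fourier–Hadamard transform of the function $x\mapsto(-1)^{\gamma_S(x)}$ is the function $2^n\Delta_0-(\widehat{1_S})^2+|S|$.
   Context: A set $S\subseteq\mathbb{F}_2^n$ is Sidon if whenever $a+b=c+d$ with $a,b,c,d\in S$, $a\neq b$, $c\neq d$, then $\{a,b\}=\{c,d\}$. $\gamma_S(a)=1$ if $a\neq0$ and $(a+S)\cap S\neq\emptyset$, else $0$. For $\varphi:\mathbb{F}_2^n\to\mathbb{Z}$, $\widehat{\varphi}(a)=\sum_{u}(-1)^{u\cdot a}\varphi(u)$; $\widehat{1_S}(a)=\sum_{x\in S}(-1)^{x\cdot a}$. $\Delta_0$ is $1$ at $0$ and $0$ elsewhere. -}

module Defs where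

open import Data.Bool using (Bool; true; false; _∧_; _xor_; not; if_then_else_)
open import Data.Nat using (ℕ; zero; suc)
open import Data.Integer using (ℤ; +_; -_; _+_; _*_)
open import Data.List using (List; []; _∷_; map; concatMap; foldr)
open import Data.Bool.ListAction using (any)
open import Data.Vec using (Vec; []; _∷_; zipWith; replicate)
open import Data.Product using (_×_)
open import Data.Sum using (_⊎_)
open import Relation.Binary.PropositionalEquality using (_≡_; _≢_)

-- F₂ is Bool (false = 0, true = 1, addition = xor, multiplication = ∧);
-- F₂ⁿ is Vec Bool n.
F2n : ℕ → Set
F2n n = Vec Bool n

_⊕_ : ∀ {n} → F2n n → F2n n → F2n n
_⊕_ = zipWith _xor_

𝟘 : ∀ {n} → F2n n
𝟘 = replicate _ false

dot : ∀ {n} → F2n n → F2n n → Bool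
dot [] [] = false
dot (x ∷ u) (y ∷ a) = (x ∧ y) xor dot u a

allVecs : (n : ℕ) → List (F2n n)
allVecs zero = [] ∷ []
allVecs (suc n) = concatMap (λ v → (false ∷ v) ∷ (true ∷ v) ∷ []) (allVecs n)

sumF : ∀ n → (F2n n → ℤ) → ℤ
sumF n f = foldr (λ v acc → f v + acc) (+ 0) (allVecs n)

sgn : Bool → ℤ
sgn false = + 1
sgn true = - (+ 1)

Subset : ℕ → Set
Subset n = F2n n → Bool

ind : ∀ {n} → Subset n → F2n n → ℤ
ind S x = if S x then + 1 else + 0

card : ∀ {n} → Subset n → ℤ
card {n} S = sumF n (ind S)

fourier : ∀ {n} → (F2n n → ℤ) → F2n n → ℤ
fourier {n} φ a = sumF n (λ u → sgn (dot u a) * φ u)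

Sidon : ∀ {n} → Subset n → Set
Sidon {n} S = ∀ (a b c d : F2n n) →
  S a ≡ true → S b ≡ true → S c ≡ true → S d ≡ true →
  a ≢ b → c ≢ d → a ⊕ b ≡ c ⊕ d →
  (a ≡ c × b ≡ d) ⊎ (a ≡ d × b ≡ c)

isZero : ∀ {n} → F2n n → Bool
isZero [] = true
isZero (false ∷ v) = isZero v
isZero (true ∷ v) = false

gammaS : ∀ {n} → Subset n → F2n n → Bool
gammaS {n} S a = not (isZero a) ∧ any (λ x → S x ∧ S (a ⊕ x)) (allVecs n)

delta0 : ∀ {n} → F2n n → ℤ
delta0 a = if isZero a then + 1 else + 0

{-# OPTIONS --safe #-}
-- Since (-1)^b = 1 - 2b, the transform of (-1)^γ_S is 2ⁿΔ₀ - 2γ̂_S. On the other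
-- side, 1̂_S² is the transform of the autocorrelation
-- (1_S ⋆ 1_S)(z) = #{x ∈ S : z + x ∈ S}, which is |S| at z = 0. For z ≠ 0, if
-- x ∈ S and z + x ∈ S then z = x + (z + x), and by the Sidon property this is the
-- only way to write z as a sum of two distinct elements of S, up to order. So the
-- count is 2γ_S(z), giving 1̂_S² = |S| + 2γ̂_S; eliminating γ̂_S gives the identity.
module Submission where

open import Defs
open import Algebra.Bundles using (CommutativeRing)
open import Data.Bool using (Bool; true; false; not; _∧_; _xor_; if_then_else_)
open import Data.Bool.Properties
  using ( ∧-idem; xor-comm; xor-assoc; xor-identityˡ; xor-identityʳ; xor-same
        ; ∧-distribʳ-xor; xor-∧-commutativeRing )
open import Data.Bool.ListAction using (any)
open import Data.Nat using (ℕ; zero; suc)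
open import Data.Integer using (ℤ; +_; _+_; _-_; _*_; _^_)
import Data.Integer.Properties as ℤ
open import Data.Integer.Tactic.RingSolver using (solve-∀)
open import Data.List using (List; []; _∷_; foldr; concatMap)
open import Data.Vec using ([]; _∷_)
open import Data.Vec.Properties
  using (zipWith-comm; zipWith-assoc; zipWith-identityˡ; zipWith-identityʳ)
open import Data.Product using (∃; _×_; _,_; proj₁; proj₂)
open import Data.Sum using (_⊎_; inj₁; inj₂)
open import Function using (_∘_)
open import Relation.Binary.PropositionalEquality
  using (_≡_; _≢_; refl; sym; trans; cong; cong₂; module ≡-Reasoning)
open import Relation.Nullary using (contradiction)
open import Algebra.Properties.CommutativeSemigroup ℤ.+-commutativeSemigroup
  using () renaming (interchange to +-interchange)
open import Algebra.Properties.CommutativeSemigroup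
  (CommutativeRing.+-commutativeSemigroup xor-∧-commutativeRing)
  using () renaming (interchange to xor-interchange)

open ≡-Reasoning

private variable A B : Set

-- sumF n f is definitionally sumL f (allVecs n), so every lemma below applies to sumF.
sumL : (A → ℤ) → List A → ℤ
sumL f = foldr (λ v acc → f v + acc) (+ 0)

sumL-cong : {f g : A → ℤ} → (∀ x → f x ≡ g x) → ∀ xs → sumL f xs ≡ sumL g xs
sumL-cong f≗g []       = refl
sumL-cong f≗g (x ∷ xs) = cong₂ _+_ (f≗g x) (sumL-cong f≗g xs)

sumL-zero : (xs : List A) → sumL (λ _ → + 0) xs ≡ + 0
sumL-zero []       = refl
sumL-zero (x ∷ xs) = trans (ℤ.+-identityˡ _) (sumL-zero xs)

sumL-+ : (f g : A → ℤ) (xs : List A) → sumL (λ x → f x + g x) xs ≡ sumL f xs + sumL g xs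
sumL-+ f g []       = refl
sumL-+ f g (x ∷ xs) =
  trans (cong (_+_ (f x + g x)) (sumL-+ f g xs))
        (+-interchange (f x) (g x) (sumL f xs) (sumL g xs))

sumL-*ˡ : ∀ c (f : A → ℤ) xs → sumL (λ x → c * f x) xs ≡ c * sumL f xs
sumL-*ˡ c f []       = sym (ℤ.*-zeroʳ c)
sumL-*ˡ c f (x ∷ xs) =
  trans (cong (_+_ (c * f x)) (sumL-*ˡ c f xs)) (sym (ℤ.*-distribˡ-+ c (f x) (sumL f xs)))

sumL-*ʳ : ∀ c (f : A → ℤ) xs → sumL (λ x → f x * c) xs ≡ sumL f xs * c
sumL-*ʳ c f []       = refl
sumL-*ʳ c f (x ∷ xs) =
  trans (cong (_+_ (f x * c)) (sumL-*ʳ c f xs)) (sym (ℤ.*-distribʳ-+ c (f x) (sumL f xs)))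

sumL-swap : (f : A → B → ℤ) (xs : List A) (ys : List B) →
  sumL (λ x → sumL (f x) ys) xs ≡ sumL (λ y → sumL (λ x → f x y) xs) ys
sumL-swap f []       ys = sym (sumL-zero ys)
sumL-swap f (x ∷ xs) ys = begin
  sumL (f x) ys + sumL (λ x → sumL (f x) ys) xs
    ≡⟨ cong (_+_ (sumL (f x) ys)) (sumL-swap f xs ys) ⟩
  sumL (f x) ys + sumL (λ y → sumL (λ x → f x y) xs) ys
    ≡⟨ sumL-+ (f x) (λ y → sumL (λ x → f x y) xs) ys ⟨
  sumL (λ y → f x y + sumL (λ x → f x y) xs) ys ∎

sumL-*-sumL : (f : A → ℤ) (g : B → ℤ) (xs : List A) (ys : List B) →
  sumL f xs * sumL g ys ≡ sumL (λ x → sumL (λ y → f x * g y) ys) xs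
sumL-*-sumL f g xs ys = begin
  sumL f xs * sumL g ys                       ≡⟨ sumL-*ʳ (sumL g ys) f xs ⟨
  sumL (λ x → f x * sumL g ys) xs             ≡⟨ sumL-cong (λ x → sym (sumL-*ˡ (f x) g ys)) xs ⟩
  sumL (λ x → sumL (λ y → f x * g y) ys) xs   ∎

sumL-concatMap-pair : (f : B → ℤ) (g h : A → B) (xs : List A) →
  sumL f (concatMap (λ v → g v ∷ h v ∷ []) xs) ≡ sumL (λ v → f (g v) + f (h v)) xs
sumL-concatMap-pair f g h []       = refl
sumL-concatMap-pair f g h (x ∷ xs) =
  trans (cong (λ t → f (g x) + (f (h x) + t)) (sumL-concatMap-pair f g h xs))
        (sym (ℤ.+-assoc (f (g x)) (f (h x)) _))

sumF-cong : ∀ n {f g : F2n n → ℤ} → (∀ x → f x ≡ g x) → sumF n f ≡ sumF n g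
sumF-cong n f≗g = sumL-cong f≗g (allVecs n)

module _ {n : ℕ} where

  ⊕-comm : (x y : F2n n) → x ⊕ y ≡ y ⊕ x
  ⊕-comm = zipWith-comm xor-comm

  ⊕-assoc : (x y z : F2n n) → (x ⊕ y) ⊕ z ≡ x ⊕ (y ⊕ z)
  ⊕-assoc = zipWith-assoc xor-assoc

  ⊕-identityˡ : (x : F2n n) → 𝟘 ⊕ x ≡ x
  ⊕-identityˡ = zipWith-identityˡ xor-identityˡ

  ⊕-identityʳ : (x : F2n n) → x ⊕ 𝟘 ≡ x
  ⊕-identityʳ = zipWith-identityʳ xor-identityʳ

⊕-self : ∀ {n} (x : F2n n) → x ⊕ x ≡ 𝟘
⊕-self []      = refl
⊕-self (b ∷ x) = cong₂ _∷_ (xor-same b) (⊕-self x)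

⊕-cancelˡ : ∀ {n} (x y : F2n n) → x ⊕ (x ⊕ y) ≡ y
⊕-cancelˡ x y = begin
  x ⊕ (x ⊕ y)  ≡⟨ ⊕-assoc x x y ⟨
  (x ⊕ x) ⊕ y  ≡⟨ cong (_⊕ y) (⊕-self x) ⟩
  𝟘 ⊕ y        ≡⟨ ⊕-identityˡ y ⟩
  y            ∎

x⊕[z⊕x]≡z : ∀ {n} (x z : F2n n) → x ⊕ (z ⊕ x) ≡ z
x⊕[z⊕x]≡z x z = trans (cong (x ⊕_) (⊕-comm z x)) (⊕-cancelˡ x z)

⊕≡𝟘⇒≡ : ∀ {n} {x y : F2n n} → x ⊕ y ≡ 𝟘 → x ≡ y
⊕≡𝟘⇒≡ {x = x} {y} x⊕y≡𝟘 = begin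
  x            ≡⟨ ⊕-identityʳ x ⟨
  x ⊕ 𝟘        ≡⟨ cong (x ⊕_) x⊕y≡𝟘 ⟨
  x ⊕ (x ⊕ y)  ≡⟨ ⊕-cancelˡ x y ⟩
  y            ∎

≢⊕-translate : ∀ {n} {z : F2n n} → z ≢ 𝟘 → ∀ x → x ≢ z ⊕ x
≢⊕-translate {z = z} z≢𝟘 x x≡z⊕x = z≢𝟘 (begin
  z            ≡⟨ x⊕[z⊕x]≡z x z ⟨
  x ⊕ (z ⊕ x)  ≡⟨ cong (x ⊕_) x≡z⊕x ⟨
  x ⊕ x        ≡⟨ ⊕-self x ⟩
  𝟘            ∎)

isZero-𝟘 : ∀ n → isZero (𝟘 {n}) ≡ true
isZero-𝟘 zero    = refl
isZero-𝟘 (suc n) = isZero-𝟘 n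

isZero⇒≡𝟘 : ∀ {n} (z : F2n n) → isZero z ≡ true → z ≡ 𝟘
isZero⇒≡𝟘 []          _        = refl
isZero⇒≡𝟘 (false ∷ z) isZero-z = cong (false ∷_) (isZero⇒≡𝟘 z isZero-z)

isZero≡false⇒≢𝟘 : ∀ {n} {z : F2n n} → isZero z ≡ false → z ≢ 𝟘
isZero≡false⇒≢𝟘 {n} isZero-z z≡𝟘
  with () ← trans (sym isZero-z) (trans (cong isZero z≡𝟘) (isZero-𝟘 n))

-- ind S and delta0 are definitionally b2z ∘ S and b2z ∘ isZero.
b2z : Bool → ℤ
b2z b = if b then + 1 else + 0

b2z-∧ : ∀ p q → b2z p * b2z q ≡ b2z (p ∧ q)
b2z-∧ false q     = refl
b2z-∧ true  false = refl
b2z-∧ true  true  = refl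

∧≡true⇒ : ∀ {p q} → p ∧ q ≡ true → p ≡ true × q ≡ true
∧≡true⇒ {true} {true} _ = refl , refl

delta0-⊕-self : ∀ {n} (x : F2n n) → delta0 (x ⊕ x) ≡ + 1
delta0-⊕-self {n} x = trans (cong delta0 (⊕-self x)) (cong b2z (isZero-𝟘 n))

delta0-⊕-≢ : ∀ {n} {x y : F2n n} → x ≢ y → delta0 (x ⊕ y) ≡ + 0
delta0-⊕-≢ {x = x} {y} x≢y with isZero (x ⊕ y) in isZero-x⊕y
... | true  = contradiction (⊕≡𝟘⇒≡ (isZero⇒≡𝟘 (x ⊕ y) isZero-x⊕y)) x≢y
... | false = refl

dot-⊕ˡ : ∀ {n} (x y a : F2n n) → dot (x ⊕ y) a ≡ dot x a xor dot y a
dot-⊕ˡ []      []      []      = refl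
dot-⊕ˡ (p ∷ x) (q ∷ y) (b ∷ a) = begin
  ((p xor q) ∧ b) xor dot (x ⊕ y) a
    ≡⟨ cong₂ _xor_ (∧-distribʳ-xor b p q) (dot-⊕ˡ x y a) ⟩
  ((p ∧ b) xor (q ∧ b)) xor (dot x a xor dot y a)
    ≡⟨ xor-interchange (p ∧ b) (q ∧ b) (dot x a) (dot y a) ⟩
  ((p ∧ b) xor dot x a) xor ((q ∧ b) xor dot y a) ∎

dot-𝟘ˡ : ∀ {n} (a : F2n n) → dot 𝟘 a ≡ false
dot-𝟘ˡ []      = refl
dot-𝟘ˡ (b ∷ a) = dot-𝟘ˡ a

sgn-xor : ∀ p q → sgn (p xor q) ≡ sgn p * sgn q
sgn-xor false q     = sym (ℤ.*-identityˡ (sgn q))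
sgn-xor true  false = refl
sgn-xor true  true  = refl

sgn-square : ∀ b → sgn b * sgn b ≡ + 1
sgn-square false = refl
sgn-square true  = refl

sgn+2b2z : ∀ b → sgn b + + 2 * b2z b ≡ + 1
sgn+2b2z false = refl
sgn+2b2z true  = refl

character : ∀ {n} → F2n n → F2n n → ℤ
character a u = sgn (dot u a)

character-⊕ : ∀ {n} (a x y : F2n n) → character a (x ⊕ y) ≡ character a x * character a y
character-⊕ a x y = trans (cong sgn (dot-⊕ˡ x y a)) (sgn-xor (dot x a) (dot y a))

character-𝟘 : ∀ {n} (a : F2n n) → character a 𝟘 ≡ + 1
character-𝟘 a = cong sgn (dot-𝟘ˡ a)

sumF-suc : ∀ n (f : F2n (suc n) → ℤ) →
  sumF (suc n) f ≡ sumF n (λ v → f (false ∷ v) + f (true ∷ v))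
sumF-suc n f = sumL-concatMap-pair f (false ∷_) (true ∷_) (allVecs n)

sumF-translate : ∀ n (x : F2n n) (f : F2n n → ℤ) → sumF n (λ y → f (x ⊕ y)) ≡ sumF n f
sumF-translate zero    []          f = refl
sumF-translate (suc n) (false ∷ x) f = begin
  sumF (suc n) (λ y → f ((false ∷ x) ⊕ y))
    ≡⟨ sumF-suc n (λ y → f ((false ∷ x) ⊕ y)) ⟩
  sumF n (λ v → f (false ∷ x ⊕ v) + f (true ∷ x ⊕ v))
    ≡⟨ sumF-translate n x (λ v → f (false ∷ v) + f (true ∷ v)) ⟩
  sumF n (λ v → f (false ∷ v) + f (true ∷ v))
    ≡⟨ sumF-suc n f ⟨
  sumF (suc n) f ∎
sumF-translate (suc n) (true ∷ x) f = begin
  sumF (suc n) (λ y → f ((true ∷ x) ⊕ y))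
    ≡⟨ sumF-suc n (λ y → f ((true ∷ x) ⊕ y)) ⟩
  sumF n (λ v → f (true ∷ x ⊕ v) + f (false ∷ x ⊕ v))
    ≡⟨ sumF-translate n x (λ v → f (true ∷ v) + f (false ∷ v)) ⟩
  sumF n (λ v → f (true ∷ v) + f (false ∷ v))
    ≡⟨ sumF-cong n (λ v → ℤ.+-comm (f (true ∷ v)) (f (false ∷ v))) ⟩
  sumF n (λ v → f (false ∷ v) + f (true ∷ v))
    ≡⟨ sumF-suc n f ⟨
  sumF (suc n) f ∎

sumF-delta0 : ∀ n → sumF n delta0 ≡ + 1
sumF-delta0 zero    = refl
sumF-delta0 (suc n) = begin
  sumF (suc n) delta0            ≡⟨ sumF-suc n delta0 ⟩
  sumF n (λ v → delta0 v + + 0)  ≡⟨ sumF-cong n (λ v → ℤ.+-identityʳ (delta0 v)) ⟩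
  sumF n delta0                  ≡⟨ sumF-delta0 n ⟩
  + 1                            ∎

sumF-character : ∀ n (a : F2n n) → sumF n (character a) ≡ (+ 2) ^ n * delta0 a
sumF-character zero    []          = refl
sumF-character (suc n) (false ∷ a) = begin
  sumF (suc n) (character (false ∷ a))          ≡⟨ sumF-suc n (character (false ∷ a)) ⟩
  sumF n (λ v → character a v + character a v)  ≡⟨ sumF-cong n (λ v → double (character a v)) ⟩
  sumF n (λ v → + 2 * character a v)            ≡⟨ sumL-*ˡ (+ 2) (character a) (allVecs n) ⟩
  + 2 * sumF n (character a)                    ≡⟨ cong (+ 2 *_) (sumF-character n a) ⟩
  + 2 * ((+ 2) ^ n * delta0 a)                  ≡⟨ ℤ.*-assoc (+ 2) ((+ 2) ^ n) (delta0 a) ⟨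
  (+ 2) ^ suc n * delta0 (false ∷ a)            ∎
  where
  double : ∀ t → t + t ≡ + 2 * t
  double = solve-∀
sumF-character (suc n) (true ∷ a) = begin
  sumF (suc n) (character (true ∷ a))                 ≡⟨ sumF-suc n (character (true ∷ a)) ⟩
  sumF n (λ v → sgn (dot v a) + sgn (not (dot v a)))  ≡⟨ sumF-cong n (λ v → sgn+sgn-not (dot v a)) ⟩
  sumF n (λ _ → + 0)                                  ≡⟨ sumL-zero (allVecs n) ⟩
  + 0                                                 ≡⟨ ℤ.*-zeroʳ ((+ 2) ^ suc n) ⟨
  (+ 2) ^ suc n * delta0 (true ∷ a)                   ∎
  where
  sgn+sgn-not : ∀ b → sgn b + sgn (not b) ≡ + 0
  sgn+sgn-not false = refl
  sgn+sgn-not true  = refl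

module _ {n : ℕ} where

  fourier-cong : {φ ψ : F2n n → ℤ} → (∀ x → φ x ≡ ψ x) → ∀ a → fourier φ a ≡ fourier ψ a
  fourier-cong φ≗ψ a = sumF-cong n (λ u → cong (character a u *_) (φ≗ψ u))

  fourier-+ : ∀ (φ ψ : F2n n → ℤ) a → fourier (λ x → φ x + ψ x) a ≡ fourier φ a + fourier ψ a
  fourier-+ φ ψ a = begin
    sumF n (λ u → character a u * (φ u + ψ u))
      ≡⟨ sumF-cong n (λ u → ℤ.*-distribˡ-+ (character a u) (φ u) (ψ u)) ⟩
    sumF n (λ u → character a u * φ u + character a u * ψ u)
      ≡⟨ sumL-+ (λ u → character a u * φ u) (λ u → character a u * ψ u) (allVecs n) ⟩
    fourier φ a + fourier ψ a ∎

  fourier-*ˡ : ∀ c (φ : F2n n → ℤ) a → fourier (λ x → c * φ x) a ≡ c * fourier φ a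
  fourier-*ˡ c φ a = begin
    sumF n (λ u → character a u * (c * φ u))
      ≡⟨ sumF-cong n (λ u → *-swap (character a u) c (φ u)) ⟩
    sumF n (λ u → c * (character a u * φ u))
      ≡⟨ sumL-*ˡ c (λ u → character a u * φ u) (allVecs n) ⟩
    c * fourier φ a ∎
    where
    *-swap : ∀ x y z → x * (y * z) ≡ y * (x * z)
    *-swap = solve-∀

  fourier-delta0 : ∀ a → fourier delta0 a ≡ + 1
  fourier-delta0 a = trans (sumF-cong n character*delta0) (sumF-delta0 n)
    where
    character*delta0 : ∀ z → character a z * delta0 z ≡ delta0 z
    character*delta0 z with isZero z in isZero-z
    ... | true  = begin
      character a z * + 1  ≡⟨ ℤ.*-identityʳ (character a z) ⟩
      character a z        ≡⟨ cong (character a) (isZero⇒≡𝟘 z isZero-z) ⟩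
      character a 𝟘        ≡⟨ character-𝟘 a ⟩
      + 1                  ∎
    ... | false = ℤ.*-zeroʳ (character a z)

  fourier-sgn : ∀ (b : F2n n → Bool) a →
    fourier (sgn ∘ b) a + + 2 * fourier (b2z ∘ b) a ≡ (+ 2) ^ n * delta0 a
  fourier-sgn b a = begin
    fourier (sgn ∘ b) a + + 2 * fourier (b2z ∘ b) a
      ≡⟨ cong (_+_ (fourier (sgn ∘ b) a)) (fourier-*ˡ (+ 2) (b2z ∘ b) a) ⟨
    fourier (sgn ∘ b) a + fourier (λ x → + 2 * b2z (b x)) a
      ≡⟨ fourier-+ (sgn ∘ b) (λ x → + 2 * b2z (b x)) a ⟨
    fourier (λ x → sgn (b x) + + 2 * b2z (b x)) a
      ≡⟨ fourier-cong (sgn+2b2z ∘ b) a ⟩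
    sumF n (λ u → character a u * + 1)
      ≡⟨ sumF-cong n (λ u → ℤ.*-identityʳ (character a u)) ⟩
    sumF n (character a)
      ≡⟨ sumF-character n a ⟩
    (+ 2) ^ n * delta0 a ∎

  _⋆_ : (F2n n → ℤ) → (F2n n → ℤ) → F2n n → ℤ
  (φ ⋆ ψ) z = sumF n (λ x → φ x * ψ (z ⊕ x))

  fourier-⋆ : ∀ (φ ψ : F2n n → ℤ) a → fourier φ a * fourier ψ a ≡ fourier (φ ⋆ ψ) a
  fourier-⋆ φ ψ a = begin
    fourier φ a * fourier ψ a
      ≡⟨ sumL-*-sumL (λ x → χ x * φ x) (λ y → χ y * ψ y) (allVecs n) (allVecs n) ⟩
    sumF n (λ x → sumF n (λ y → (χ x * φ x) * (χ y * ψ y)))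
      ≡⟨ sumF-cong n (λ x → sumF-translate n x (λ y → (χ x * φ x) * (χ y * ψ y))) ⟨
    sumF n (λ x → sumF n (λ w → (χ x * φ x) * (χ (x ⊕ w) * ψ (x ⊕ w))))
      ≡⟨ sumF-cong n (λ x → sumF-cong n (summand x)) ⟩
    sumF n (λ x → sumF n (λ w → χ w * (φ x * ψ (w ⊕ x))))
      ≡⟨ sumL-swap (λ x w → χ w * (φ x * ψ (w ⊕ x))) (allVecs n) (allVecs n) ⟩
    sumF n (λ w → sumF n (λ x → χ w * (φ x * ψ (w ⊕ x))))
      ≡⟨ sumF-cong n (λ w → sumL-*ˡ (χ w) (λ x → φ x * ψ (w ⊕ x)) (allVecs n)) ⟩
    fourier (φ ⋆ ψ) a ∎
    where
    χ : F2n n → ℤ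
    χ = character a
    rearrange : ∀ c d p q → (c * p) * ((c * d) * q) ≡ (c * c) * (d * (p * q))
    rearrange = solve-∀
    summand : ∀ x w → (χ x * φ x) * (χ (x ⊕ w) * ψ (x ⊕ w)) ≡ χ w * (φ x * ψ (w ⊕ x))
    summand x w = begin
      (χ x * φ x) * (χ (x ⊕ w) * ψ (x ⊕ w))
        ≡⟨ cong₂ (λ c v → (χ x * φ x) * (c * ψ v)) (character-⊕ a x w) (⊕-comm x w) ⟩
      (χ x * φ x) * ((χ x * χ w) * ψ (w ⊕ x))
        ≡⟨ rearrange (χ x) (χ w) (φ x) (ψ (w ⊕ x)) ⟩
      (χ x * χ x) * (χ w * (φ x * ψ (w ⊕ x)))
        ≡⟨ cong (_* (χ w * (φ x * ψ (w ⊕ x)))) (sgn-square (dot x a)) ⟩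
      + 1 * (χ w * (φ x * ψ (w ⊕ x)))
        ≡⟨ ℤ.*-identityˡ _ ⟩
      χ w * (φ x * ψ (w ⊕ x)) ∎

sumL-b2z-any-false : (p : A → Bool) (xs : List A) → any p xs ≡ false → sumL (b2z ∘ p) xs ≡ + 0
sumL-b2z-any-false p []       _         = refl
sumL-b2z-any-false p (x ∷ xs) any-false with p x
... | false = trans (ℤ.+-identityˡ _) (sumL-b2z-any-false p xs any-false)

any-witness : (p : A → Bool) (xs : List A) → any p xs ≡ true → ∃ λ x → p x ≡ true
any-witness p (x ∷ xs) any-true with p x in px
... | true  = x , px
... | false = any-witness p xs any-true

sumF-b2z-two-points : ∀ {n} (p : F2n n → Bool) {u v : F2n n} → u ≢ v →
  p u ≡ true → p v ≡ true → (∀ x → p x ≡ true → x ≡ u ⊎ x ≡ v) → sumF n (b2z ∘ p) ≡ + 2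
sumF-b2z-two-points {n} p {u} {v} u≢v pu pv only = begin
  sumF n (b2z ∘ p)
    ≡⟨ sumF-cong n indicator ⟩
  sumF n (λ x → delta0 (u ⊕ x) + delta0 (v ⊕ x))
    ≡⟨ sumL-+ (λ x → delta0 (u ⊕ x)) (λ x → delta0 (v ⊕ x)) (allVecs n) ⟩
  sumF n (λ x → delta0 (u ⊕ x)) + sumF n (λ x → delta0 (v ⊕ x))
    ≡⟨ cong₂ _+_ (point-mass u) (point-mass v) ⟩
  + 2 ∎
  where
  point-mass : ∀ w → sumF n (λ x → delta0 (w ⊕ x)) ≡ + 1
  point-mass w = trans (sumF-translate n w delta0) (sumF-delta0 n)
  indicator : ∀ x → b2z (p x) ≡ delta0 (u ⊕ x) + delta0 (v ⊕ x)
  indicator x with p x in px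
  ... | true with only x px
  ...   | inj₁ refl = sym (cong₂ _+_ (delta0-⊕-self x) (delta0-⊕-≢ (u≢v ∘ sym)))
  ...   | inj₂ refl = sym (cong₂ _+_ (delta0-⊕-≢ u≢v) (delta0-⊕-self x))
  indicator x | false = sym (cong₂ _+_ (delta0-⊕-≢ (≢x pu)) (delta0-⊕-≢ (≢x pv)))
    where
    ≢x : ∀ {w} → p w ≡ true → w ≢ x
    ≢x pw refl = contradiction (trans (sym pw) px) λ ()

module _ {n : ℕ} (S : Subset n) where

  represents : F2n n → F2n n → Bool
  represents z x = S x ∧ S (z ⊕ x)

  ind⋆ind-𝟘 : (ind S ⋆ ind S) 𝟘 ≡ card S
  ind⋆ind-𝟘 = sumF-cong n square
    where
    square : ∀ x → ind S x * ind S (𝟘 ⊕ x) ≡ ind S x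
    square x = trans (cong (λ y → ind S x * ind S y) (⊕-identityˡ x))
                     (trans (b2z-∧ (S x) (S x)) (cong b2z (∧-idem (S x))))

  ind⋆ind-represents : ∀ z → (ind S ⋆ ind S) z ≡ sumF n (b2z ∘ represents z)
  ind⋆ind-represents z = sumF-cong n (λ x → b2z-∧ (S x) (S (z ⊕ x)))

  sidon-partner : Sidon S → ∀ {z x₀ x} → z ≢ 𝟘 → S x₀ ≡ true → S (z ⊕ x₀) ≡ true →
    S x ≡ true → S (z ⊕ x) ≡ true → x ≡ x₀ ⊎ x ≡ z ⊕ x₀
  sidon-partner sidon {z} {x₀} {x} z≢𝟘 Sx₀ Sy₀ Sx Sy
    with sidon x (z ⊕ x) x₀ (z ⊕ x₀) Sx Sy Sx₀ Sy₀
               (≢⊕-translate z≢𝟘 x) (≢⊕-translate z≢𝟘 x₀)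
               (trans (x⊕[z⊕x]≡z x z) (sym (x⊕[z⊕x]≡z x₀ z)))
  ... | inj₁ (x≡x₀ , _) = inj₁ x≡x₀
  ... | inj₂ (x≡y₀ , _) = inj₂ x≡y₀

  sidon-ind⋆ind-≢𝟘 : Sidon S → ∀ {z} → z ≢ 𝟘 →
    (ind S ⋆ ind S) z ≡ + 2 * b2z (any (represents z) (allVecs n))
  sidon-ind⋆ind-≢𝟘 sidon {z} z≢𝟘 with any (represents z) (allVecs n) in any-eq
  ... | false = trans (ind⋆ind-represents z) (sumL-b2z-any-false (represents z) (allVecs n) any-eq)
  ... | true with any-witness (represents z) (allVecs n) any-eq
  ...   | x₀ , rep-x₀ = trans (ind⋆ind-represents z)
            (sumF-b2z-two-points (represents z) (≢⊕-translate z≢𝟘 x₀) rep-x₀ rep-y₀ only)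
    where
    Sx₀ : S x₀ ≡ true
    Sx₀ = proj₁ (∧≡true⇒ rep-x₀)
    Sy₀ : S (z ⊕ x₀) ≡ true
    Sy₀ = proj₂ (∧≡true⇒ rep-x₀)
    rep-y₀ : represents z (z ⊕ x₀) ≡ true
    rep-y₀ = cong₂ _∧_ Sy₀ (trans (cong S (⊕-cancelˡ z x₀)) Sx₀)
    only : ∀ x → represents z x ≡ true → x ≡ x₀ ⊎ x ≡ z ⊕ x₀
    only x rep-x with ∧≡true⇒ rep-x
    ... | Sx , Sy = sidon-partner sidon z≢𝟘 Sx₀ Sy₀ Sx Sy

  sidon-ind⋆ind : Sidon S → ∀ z →
    (ind S ⋆ ind S) z ≡ card S * delta0 z + + 2 * b2z (gammaS S z)
  sidon-ind⋆ind sidon z with isZero z in isZero-z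
  ... | true  = begin
    (ind S ⋆ ind S) z         ≡⟨ cong (ind S ⋆ ind S) (isZero⇒≡𝟘 z isZero-z) ⟩
    (ind S ⋆ ind S) 𝟘         ≡⟨ ind⋆ind-𝟘 ⟩
    card S                    ≡⟨ ℤ.*-identityʳ (card S) ⟨
    card S * + 1              ≡⟨ ℤ.+-identityʳ (card S * + 1) ⟨
    card S * + 1 + + 2 * + 0  ∎
  ... | false = begin
    (ind S ⋆ ind S) z         ≡⟨ sidon-ind⋆ind-≢𝟘 sidon (isZero≡false⇒≢𝟘 isZero-z) ⟩
    + 2 * r                   ≡⟨ ℤ.+-identityˡ (+ 2 * r) ⟨
    + 0 + + 2 * r             ≡⟨ cong (_+ + 2 * r) (ℤ.*-zeroʳ (card S)) ⟨
    card S * + 0 + + 2 * r    ∎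
    where
    r : ℤ
    r = b2z (any (represents z) (allVecs n))

  sidon-fourier-ind-square : Sidon S → ∀ a →
    fourier (ind S) a * fourier (ind S) a ≡ card S + + 2 * fourier (b2z ∘ gammaS S) a
  sidon-fourier-ind-square sidon a = begin
    fourier (ind S) a * fourier (ind S) a
      ≡⟨ fourier-⋆ (ind S) (ind S) a ⟩
    fourier (ind S ⋆ ind S) a
      ≡⟨ fourier-cong (sidon-ind⋆ind sidon) a ⟩
    fourier (λ z → card S * delta0 z + + 2 * γ z) a
      ≡⟨ fourier-+ (λ z → card S * delta0 z) (λ z → + 2 * γ z) a ⟩
    fourier (λ z → card S * delta0 z) a + fourier (λ z → + 2 * γ z) a
      ≡⟨ cong₂ _+_ (fourier-*ˡ (card S) delta0 a) (fourier-*ˡ (+ 2) γ a) ⟩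
    card S * fourier delta0 a + + 2 * fourier γ a
      ≡⟨ cong (λ t → card S * t + + 2 * fourier γ a) (fourier-delta0 a) ⟩
    card S * + 1 + + 2 * fourier γ a
      ≡⟨ cong (_+ + 2 * fourier γ a) (ℤ.*-identityʳ (card S)) ⟩
    card S + + 2 * fourier γ a ∎
    where
    γ : F2n n → ℤ
    γ = b2z ∘ gammaS S

lemma4p11 : (n : ℕ) (S : Subset n) → Sidon S →
    ∀ (a : F2n n) →
      fourier (λ x → sgn (gammaS S x)) a
        ≡ ((+ 2) ^ n) * delta0 a - fourier (ind S) a * fourier (ind S) a + card S
lemma4p11 n S sidon a = begin
  fourier (sgn ∘ gammaS S) a
    ≡⟨ eliminate (fourier (sgn ∘ gammaS S) a) (fourier (b2z ∘ gammaS S) a) (card S) ⟩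
  (fourier (sgn ∘ gammaS S) a + + 2 * fourier (b2z ∘ gammaS S) a)
    - (card S + + 2 * fourier (b2z ∘ gammaS S) a) + card S
    ≡⟨ cong₂ (λ p q → p - q + card S) (fourier-sgn (gammaS S) a)
                                      (sym (sidon-fourier-ind-square S sidon a)) ⟩
  (+ 2) ^ n * delta0 a - fourier (ind S) a * fourier (ind S) a + card S ∎
  where
  eliminate : ∀ l x c → l ≡ (l + + 2 * x) - (c + + 2 * x) + c
  eliminate = solve-∀
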